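{- Let $G$ be a connected graph, and let $G'$ be a connected graph obtained from $G$ by contracting some edges. Then $rx_4(G)\le rx_4(G')+|V(G)|-|V(G')|$.
   Context: To contract an edge $e=uv$ is to delete $e$ and replace its ends by a single vertex incident to all edges that were incident to $u$ or $v$. For a connected graph $H$, an edge-coloring $c:E(H)\to\{1,\dots,q\}$ (adjacent edges may get the same color) is a $4$-rainbow coloring if for every set $S$ of $4$ vertices there is a tree in $H$ containing $S$ whose edges have pairwise distinct colors. $rx_4(H)$ is the minimum $q$ for which such a coloring exists. -}

module Defs where

open import Data.Nat using (ℕ; zero; suc; _+_; _∸_; _≤_; _<_)
open import Data.Fin using (Fin)
open import Data.Bool using (Bool; true; false)
open import Data.Product using (Σ; ∃; _×_; _,_)
open import Data.Sum using (_⊎_)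
open import Relation.Binary.PropositionalEquality using (_≡_; _≢_)
open import Function.Definitions using (Injective)

record Graph (n : ℕ) : Set where
  field
    adj     : Fin n → Fin n → Bool
    adj-sym : ∀ u v → adj u v ≡ adj v u
    adj-irr : ∀ u → adj u u ≡ false

open Graph public

data Walk {n : ℕ} (G : Graph n) : Fin n → Fin n → Set where
  [] : ∀ {u} → Walk G u u
  _∷_ : ∀ {u w v} → adj G u w ≡ true → Walk G w v → Walk G u v

Connected : ∀ {n} → Graph n → Set
Connected G = ∀ u v → Walk G u v

-- Edge contraction (simple-graph version: loops and parallel edges
-- arising from the contraction are discarded).
--
-- ContractEdge G u v G' : u v is an edge of G, and G' is (an isomorphic
-- copy of) the graph obtained from G by contracting uv.

record ContractEdge {n : ℕ} (G : Graph (suc n)) (u v : Fin (suc n))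
                    (G' : Graph n) : Set where
  field
    edge   : adj G u v ≡ true
    φ      : Fin (suc n) → Fin n
    φ-uv   : φ u ≡ φ v
    φ-inj  : ∀ a b → φ a ≡ φ b → a ≡ b ⊎ ((a ≡ u × b ≡ v) ⊎ (a ≡ v × b ≡ u))
    φ-onto : ∀ x → ∃ λ a → φ a ≡ x
    adj-to   : ∀ x y → adj G' x y ≡ true →
               ∃ λ a → ∃ λ b → adj G a b ≡ true × φ a ≡ x × φ b ≡ y
    adj-from : ∀ a b → adj G a b ≡ true → φ a ≢ φ b → adj G' (φ a) (φ b) ≡ true

record Iso {n m : ℕ} (G : Graph n) (H : Graph m) : Set where
  field
    f     : Fin n → Fin m
    g     : Fin m → Fin n
    fg    : ∀ x → f (g x) ≡ x
    gf    : ∀ a → g (f a) ≡ a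
    f-adj : ∀ a b → adj H (f a) (f b) ≡ adj G a b

data Contraction : ∀ {n m} → Graph n → Graph m → Set where
  done : ∀ {n m} {G : Graph n} {H : Graph m} → Iso G H → Contraction G H
  step : ∀ {n m} {G : Graph (suc n)} {G₁ : Graph n} {H : Graph m} {u v} →
         ContractEdge G u v G₁ → Contraction G₁ H → Contraction G H

-- Edge colourings with colours 0 … q-1 (i.e. q colours); adjacent edges
-- may share a colour.  Values on non-edges are irrelevant.

record Coloring {n : ℕ} (G : Graph n) (q : ℕ) : Set where
  field
    col     : Fin n → Fin n → ℕ
    col-sym : ∀ u v → col u v ≡ col v u
    col-<   : ∀ u v → adj G u v ≡ true → col u v < q

open Coloring public

-- A (sub)tree of G is given as a rooted tree: vertex set
-- inT, root, and for every non-root vertex v of the tree a parent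
-- (a tree vertex adjacent to v) of strictly smaller depth.  Its edges are
-- the edges {v , parent v} for non-root tree vertices v.  Every subtree
-- of G arises this way and every such structure is a subtree of G.

record Tree {n : ℕ} (G : Graph n) : Set where
  field
    inT    : Fin n → Bool
    root   : Fin n
    root∈  : inT root ≡ true
    parent : Fin n → Fin n
    depth  : Fin n → ℕ
    parent∈     : ∀ v → inT v ≡ true → v ≢ root → inT (parent v) ≡ true
    parent-adj  : ∀ v → inT v ≡ true → v ≢ root → adj G v (parent v) ≡ true
    parent-depth : ∀ v → inT v ≡ true → v ≢ root → depth (parent v) < depth v

open Tree public

Rainbow : ∀ {n q} {G : Graph n} → Coloring G q → Tree G → Set
Rainbow c T = ∀ v w → inT T v ≡ true → v ≢ root T →
                      inT T w ≡ true → w ≢ root T → v ≢ w →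
                      col c v (parent T v) ≢ col c w (parent T w)

Is4Rainbow : ∀ {n q} {G : Graph n} → Coloring G q → Set
Is4Rainbow {n} {q} {G} c =
  (S : Fin 4 → Fin n) → Injective _≡_ _≡_ S →
  Σ (Tree G) λ T → Rainbow c T × (∀ i → inT T (S i) ≡ true)

rx4 : ∀ {n} → Graph n → ℕ → Set
rx4 G k = (Σ (Coloring G k) Is4Rainbow)
        × (∀ q → Σ (Coloring G q) Is4Rainbow → k ≤ q)

-- Contracting an edge uv removes one vertex, so it suffices to turn a 4-rainbow colouring of
-- G/uv with q colours into one of G with q + 1 colours: an edge of G gets the colour of its
-- image, and the edge uv gets the new colour q.  A rainbow tree of G/uv through the images of
-- four vertices lifts to G by lifting each tree edge to an edge of G and attaching the second
-- vertex of the fibre {u, v} to the first by uv; the lifted tree uses every old colour at most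
-- once and the new colour at most once.

module Submission where

open import Defs hiding ([]; _∷_)
open import Data.Nat using (ℕ; zero; suc; _+_; _∸_; _*_; _≤_; _<_)
open import Data.Nat.Properties
  using (≤-refl; ≤-trans; ≤-<-trans; <-≤-trans; <-irrefl; <⇒≤; <⇒≱; n≤1+n; n<1+n; m<n⇒m<1+n;
         m≤n⇒m≤1+n; m≤m+n; *-suc; *-monoʳ-≤; +-suc; +-∸-assoc)
open import Data.Fin using (Fin; zero; suc; _≟_)
open import Data.Fin.Properties using (any?; all?; ¬∀⟶∃¬; injective⇒≤)
open import Data.Vec.Functional using (_∷_)
open import Data.Bool using (true)
open import Data.Bool.Properties using () renaming (_≟_ to _≟ᵇ_)
open import Data.Product using (Σ; ∃; _×_; _,_; proj₁; proj₂; map)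
open import Data.Sum using (inj₁; inj₂)
open import Function using (id; _∘_)
open import Function.Definitions using (Injective)
open import Relation.Nullary using (Dec; yes; no; contradiction)
open import Relation.Nullary.Decidable using (_×-dec_; ¬?)
open import Relation.Binary.PropositionalEquality

∃-∉-image : ∀ {k n} → k < n → (g : Fin k → Fin n) → ∃ λ x → ∀ j → g j ≢ x
∃-∉-image {k} {n} k<n g with all? (λ x → any? (λ j → g j ≟ x))
... | no ¬surjective with ¬∀⟶∃¬ n _ (λ x → any? (λ j → g j ≟ x)) ¬surjective
...   | x , x∉ = x , λ j e → x∉ (j , e)
∃-∉-image {k} {n} k<n g | yes surjective = contradiction (injective⇒≤ section-injective) (<⇒≱ k<n)
  where
  section-injective : Injective _≡_ _≡_ (λ x → proj₁ (surjective x))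
  section-injective {x} {y} e =
    trans (sym (proj₂ (surjective x))) (trans (cong g e) (proj₂ (surjective y)))

∷-injective : ∀ {k n} {x : Fin n} {g : Fin k → Fin n} →
              Injective _≡_ _≡_ g → (∀ j → g j ≢ x) → Injective _≡_ _≡_ (x ∷ g)
∷-injective g-inj x∉ {zero}  {zero}  _ = refl
∷-injective g-inj x∉ {zero}  {suc j} e = contradiction (sym e) (x∉ j)
∷-injective g-inj x∉ {suc i} {zero}  e = contradiction e (x∉ i)
∷-injective g-inj x∉ {suc i} {suc j} e = cong suc (g-inj e)

injective-cover : ∀ {k n} → k ≤ n → (f : Fin k → Fin n) →
                  Σ (Fin k → Fin n) λ g → Injective _≡_ _≡_ g × (∀ i → ∃ λ j → g j ≡ f i)
injective-cover {zero} _ f = (λ ()) , (λ { {()} }) , λ ()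
injective-cover {suc k} k<n f with injective-cover (<⇒≤ k<n) (f ∘ suc)
... | g , g-inj , g-covers = proj₁ new ∷ g , ∷-injective g-inj (proj₁ (proj₂ new)) , covers
  where
  new : Σ (Fin _) λ x → (∀ j → g j ≢ x) × ∃ λ j → (x ∷ g) j ≡ f zero
  new with any? (λ j → g j ≟ f zero)
  ... | no f0∉ = f zero , (λ j e → f0∉ (j , e)) , zero , refl
  ... | yes (j , e) with ∃-∉-image k<n g
  ...   | x , x∉ = x , x∉ , suc j , e
  covers : ∀ i → ∃ λ j → (proj₁ new ∷ g) j ≡ f i
  covers zero    = proj₂ (proj₂ new)
  covers (suc i) = map suc id (g-covers i)

Rainbow4Coloring : ∀ {n} → Graph n → ℕ → Set
Rainbow4Coloring G q = Σ (Coloring G q) Is4Rainbow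

weaken-colors : ∀ {n r s} {G : Graph n} → r ≤ s → Rainbow4Coloring G r → Rainbow4Coloring G s
weaken-colors r≤s (c , rainbow) =
  record { col = col c ; col-sym = col-sym c ; col-< = λ a b e → <-≤-trans (col-< c a b e) r≤s } ,
  rainbow

module Pullback {n m} {G : Graph n} {H : Graph m} (I : Iso G H) where
  open Iso I

  f-injective : Injective _≡_ _≡_ f
  f-injective {a} {b} e = trans (sym (gf a)) (trans (cong g e) (gf b))

  ≢g⇒f≢ : ∀ {a x} → a ≢ g x → f a ≢ x
  ≢g⇒f≢ a≢gx e = a≢gx (trans (sym (gf _)) (cong g e))

  pullbackColoring : ∀ {q} → Coloring H q → Coloring G q
  pullbackColoring c = record
    { col     = λ a b → col c (f a) (f b)
    ; col-sym = λ a b → col-sym c (f a) (f b)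
    ; col-<   = λ a b e → col-< c (f a) (f b) (trans (f-adj a b) e)
    }

  pullbackTree : Tree H → Tree G
  pullbackTree T = record
    { inT          = λ a → inT T (f a)
    ; root         = g (root T)
    ; root∈        = trans (cong (inT T) (fg _)) (root∈ T)
    ; parent       = λ a → g (parent T (f a))
    ; depth        = λ a → depth T (f a)
    ; parent∈      = λ a a∈ a≢r →
        trans (cong (inT T) (fg _)) (parent∈ T (f a) a∈ (≢g⇒f≢ a≢r))
    ; parent-adj   = λ a a∈ a≢r →
        trans (sym (f-adj a _)) (trans (cong (adj H (f a)) (fg _)) (parent-adj T (f a) a∈ (≢g⇒f≢ a≢r)))
    ; parent-depth = λ a a∈ a≢r →
        subst (λ x → depth T x < depth T (f a)) (sym (fg _)) (parent-depth T (f a) a∈ (≢g⇒f≢ a≢r))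
    }

  pullback-rainbow : ∀ {q} {c : Coloring H q} {T : Tree H} →
                     Rainbow c T → Rainbow (pullbackColoring c) (pullbackTree T)
  pullback-rainbow {c = c} {T} rainbow a b a∈ a≢r b∈ b≢r a≢b e =
    rainbow (f a) (f b) a∈ (≢g⇒f≢ a≢r) b∈ (≢g⇒f≢ b≢r) (a≢b ∘ f-injective)
      (trans (cong (col c (f a)) (sym (fg _))) (trans e (cong (col c (f b)) (fg _))))

  pullback-4rainbow : ∀ {q} → Rainbow4Coloring H q → Rainbow4Coloring G q
  pullback-4rainbow (c , rainbow) = pullbackColoring c , λ S S-inj →
    let T , T-rainbow , S∈T = rainbow (f ∘ S) (S-inj ∘ f-injective)
    in pullbackTree T , pullback-rainbow {c = c} {T} T-rainbow , S∈T

module Uncontraction {n} {G : Graph (suc n)} {G₁ : Graph n} {u v : Fin (suc n)}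
                     (CE : ContractEdge G u v G₁) where
  open ContractEdge CE

  merged-unique : ∀ {a b c} → a ≢ c → b ≢ c → φ a ≡ φ c → φ b ≡ φ c → a ≡ b
  merged-unique {a} {b} {c} a≢c b≢c φa≡φc φb≡φc with φ-inj a c φa≡φc | φ-inj b c φb≡φc
  ... | inj₁ a≡c | _        = contradiction a≡c a≢c
  ... | _        | inj₁ b≡c = contradiction b≡c b≢c
  ... | inj₂ (inj₁ (a≡u , _))   | inj₂ (inj₁ (b≡u , _))   = trans a≡u (sym b≡u)
  ... | inj₂ (inj₂ (a≡v , _))   | inj₂ (inj₂ (b≡v , _))   = trans a≡v (sym b≡v)
  ... | inj₂ (inj₁ (a≡u , _))   | inj₂ (inj₂ (_ , c≡u))   = contradiction (trans a≡u (sym c≡u)) a≢c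
  ... | inj₂ (inj₂ (a≡v , _))   | inj₂ (inj₁ (_ , c≡v))   = contradiction (trans a≡v (sym c≡v)) a≢c

  merged-adjacent : ∀ {a c} → a ≢ c → φ a ≡ φ c → adj G a c ≡ true
  merged-adjacent {a} {c} a≢c φa≡φc with φ-inj a c φa≡φc
  ... | inj₁ a≡c                 = contradiction a≡c a≢c
  ... | inj₂ (inj₁ (refl , refl)) = edge
  ... | inj₂ (inj₂ (refl , refl)) = trans (adj-sym G v u) edge

  merged-φ≡φu : ∀ {a c} → a ≢ c → φ a ≡ φ c → φ a ≡ φ u
  merged-φ≡φu {a} {c} a≢c φa≡φc with φ-inj a c φa≡φc
  ... | inj₁ a≡c                 = contradiction a≡c a≢c
  ... | inj₂ (inj₁ (a≡u , _))    = cong φ a≡u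
  ... | inj₂ (inj₂ (a≡v , _))    = trans (cong φ a≡v) (sym φ-uv)

  module _ {q} (c₁ : Coloring G₁ q) where

    extendCol : Fin (suc n) → Fin (suc n) → ℕ
    extendCol a b with φ a ≟ φ b
    ... | yes _ = q
    ... | no _  = col c₁ (φ a) (φ b)

    extendCol-merged : ∀ {a b} → φ a ≡ φ b → extendCol a b ≡ q
    extendCol-merged {a} {b} φa≡φb with φ a ≟ φ b
    ... | yes _     = refl
    ... | no φa≢φb = contradiction φa≡φb φa≢φb

    extendCol-separate : ∀ {a b} → φ a ≢ φ b → extendCol a b ≡ col c₁ (φ a) (φ b)
    extendCol-separate {a} {b} φa≢φb with φ a ≟ φ b
    ... | yes φa≡φb = contradiction φa≡φb φa≢φb
    ... | no _      = refl

    extendColoring : Coloring G (suc q)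
    extendColoring = record { col = extendCol ; col-sym = extendCol-sym ; col-< = extendCol-< }
      where
      extendCol-sym : ∀ a b → extendCol a b ≡ extendCol b a
      extendCol-sym a b with φ a ≟ φ b
      ... | yes φa≡φb = sym (extendCol-merged (sym φa≡φb))
      ... | no φa≢φb  = trans (col-sym c₁ (φ a) (φ b)) (sym (extendCol-separate (φa≢φb ∘ sym)))
      extendCol-< : ∀ a b → adj G a b ≡ true → extendCol a b < suc q
      extendCol-< a b ab with φ a ≟ φ b
      ... | yes _     = n<1+n q
      ... | no φa≢φb = m<n⇒m<1+n (col-< c₁ (φ a) (φ b) (adj-from a b ab φa≢φb))

  record Representative (T₁ : Tree G₁) (x : Fin n) : Set where
    field
      rep          : Fin (suc n)
      φ-rep        : φ rep ≡ x
      up           : Fin (suc n)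
      lifts-parent : inT T₁ x ≡ true → x ≢ root T₁ → adj G rep up ≡ true × φ up ≡ parent T₁ x

  representative : (T₁ : Tree G₁) (x : Fin n) → Representative T₁ x
  representative T₁ x with (inT T₁ x ≟ᵇ true) ×-dec ¬? (x ≟ root T₁)
  ... | yes (x∈ , x≢r) with adj-to x (parent T₁ x) (parent-adj T₁ x x∈ x≢r)
  ...   | a , b , ab , φa , φb = record { rep = a ; φ-rep = φa ; up = b ; lifts-parent = λ _ _ → ab , φb }
  representative T₁ x | no ¬non-root with φ-onto x
  ...   | a , φa = record { rep = a ; φ-rep = φa ; up = a
                          ; lifts-parent = λ x∈ x≢r → contradiction (x∈ , x≢r) ¬non-root }

  -- Representatives sit at even depth 2 d, the other end of the contracted edge at odd depth
  -- just below its representative.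
  module LiftTree (T₁ : Tree G₁) where
    open module R x = Representative (representative T₁ x)

    d₁ : Fin n → ℕ
    d₁ = depth T₁

    liftParent : Fin (suc n) → Fin (suc n)
    liftParent a with a ≟ rep (φ a)
    ... | yes _ = up (φ a)
    ... | no _  = rep (φ a)

    liftDepth : Fin (suc n) → ℕ
    liftDepth a with a ≟ rep (φ a)
    ... | yes _ = 2 * d₁ (φ a)
    ... | no _  = suc (2 * d₁ (φ a))

    liftDepth-≤ : ∀ a → liftDepth a ≤ suc (2 * d₁ (φ a))
    liftDepth-≤ a with a ≟ rep (φ a)
    ... | yes _ = n≤1+n _
    ... | no _  = ≤-refl

    liftDepth-rep : ∀ x → liftDepth (rep x) ≡ 2 * d₁ x
    liftDepth-rep x with rep x ≟ rep (φ (rep x))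
    ... | yes _     = cong (λ y → 2 * d₁ y) (φ-rep x)
    ... | no r≢r   = contradiction (cong rep (sym (φ-rep x))) r≢r

    φ-rep-non-root : ∀ {a} → a ≡ rep (φ a) → a ≢ rep (root T₁) → φ a ≢ root T₁
    φ-rep-non-root a≡r a≢root φa≡root = a≢root (trans a≡r (cong rep φa≡root))

    parent≢ : ∀ x → inT T₁ x ≡ true → x ≢ root T₁ → parent T₁ x ≢ x
    parent≢ x x∈ x≢r e = <-irrefl (cong d₁ e) (parent-depth T₁ x x∈ x≢r)

    non-rep-unique : ∀ {a b} → a ≢ rep (φ a) → b ≢ rep (φ b) → a ≡ b
    non-rep-unique {a} {b} a≢rep b≢rep =
      merged-unique a≢rep (subst (λ y → b ≢ rep y) (sym φa≡φb) b≢rep)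
        (sym (φ-rep (φ a))) (trans (sym φa≡φb) (sym (φ-rep (φ a))))
      where
      φa≡φb : φ a ≡ φ b
      φa≡φb = trans (merged-φ≡φu a≢rep (sym (φ-rep (φ a)))) (sym (merged-φ≡φu b≢rep (sym (φ-rep (φ b)))))

    2*-<-suc : ∀ {i j} → i < j → suc (2 * i) < 2 * j
    2*-<-suc {i} {j} i<j = subst (_≤ 2 * j) (*-suc 2 i) (*-monoʳ-≤ 2 i<j)

    liftTree : Tree G
    liftTree = record
      { inT          = λ a → inT T₁ (φ a)
      ; root         = rep (root T₁)
      ; root∈        = trans (cong (inT T₁) (φ-rep _)) (root∈ T₁)
      ; parent       = liftParent
      ; depth        = liftDepth
      ; parent∈      = liftParent∈
      ; parent-adj   = liftParent-adj
      ; parent-depth = liftParent-depth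
      }
      where
      liftParent∈ : ∀ a → inT T₁ (φ a) ≡ true → a ≢ rep (root T₁) → inT T₁ (φ (liftParent a)) ≡ true
      liftParent∈ a a∈ a≢r with a ≟ rep (φ a)
      ... | yes a≡r = let φa≢r = φ-rep-non-root a≡r a≢r in
            trans (cong (inT T₁) (proj₂ (lifts-parent (φ a) a∈ φa≢r))) (parent∈ T₁ (φ a) a∈ φa≢r)
      ... | no _    = trans (cong (inT T₁) (φ-rep (φ a))) a∈
      liftParent-adj : ∀ a → inT T₁ (φ a) ≡ true → a ≢ rep (root T₁) → adj G a (liftParent a) ≡ true
      liftParent-adj a a∈ a≢r with a ≟ rep (φ a)
      ... | yes a≡r = subst (λ b → adj G b (up (φ a)) ≡ true) (sym a≡r)
                        (proj₁ (lifts-parent (φ a) a∈ (φ-rep-non-root a≡r a≢r)))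
      ... | no a≢rep = merged-adjacent a≢rep (sym (φ-rep (φ a)))
      liftParent-depth : ∀ a → inT T₁ (φ a) ≡ true → a ≢ rep (root T₁) → liftDepth (liftParent a) < liftDepth a
      liftParent-depth a a∈ a≢r with a ≟ rep (φ a)
      ... | yes a≡r = let φa≢r = φ-rep-non-root a≡r a≢r in
            ≤-<-trans (liftDepth-≤ (up (φ a)))
              (subst (λ y → suc (2 * d₁ y) < 2 * d₁ (φ a)) (sym (proj₂ (lifts-parent (φ a) a∈ φa≢r)))
                (2*-<-suc (parent-depth T₁ (φ a) a∈ φa≢r)))
      ... | no _    = subst (_< suc (2 * d₁ (φ a))) (sym (liftDepth-rep (φ a))) (n<1+n _)

    module _ {q} (c₁ : Coloring G₁ q) where

      liftParent-col-rep : ∀ {a} → inT T₁ (φ a) ≡ true → a ≢ rep (root T₁) → a ≡ rep (φ a) →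
                           extendCol c₁ a (liftParent a) ≡ col c₁ (φ a) (parent T₁ (φ a))
      liftParent-col-rep {a} a∈ a≢r a≡r with a ≟ rep (φ a)
      ... | no a≢rep = contradiction a≡r a≢rep
      ... | yes _    = trans (extendCol-separate c₁ φa≢φup) (cong (col c₁ (φ a)) φup≡parent)
        where
        φa≢r : φ a ≢ root T₁
        φa≢r = φ-rep-non-root a≡r a≢r
        φup≡parent : φ (up (φ a)) ≡ parent T₁ (φ a)
        φup≡parent = proj₂ (lifts-parent (φ a) a∈ φa≢r)
        φa≢φup : φ a ≢ φ (up (φ a))
        φa≢φup e = parent≢ (φ a) a∈ φa≢r (sym (trans e φup≡parent))

      liftParent-col-other : ∀ {a} → a ≢ rep (φ a) → extendCol c₁ a (liftParent a) ≡ q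
      liftParent-col-other {a} a≢rep with a ≟ rep (φ a)
      ... | yes a≡r = contradiction a≡r a≢rep
      ... | no _    = extendCol-merged c₁ (sym (φ-rep (φ a)))

      liftParent-col-rep-< : ∀ {a} → inT T₁ (φ a) ≡ true → a ≢ rep (root T₁) → a ≡ rep (φ a) →
                             extendCol c₁ a (liftParent a) < q
      liftParent-col-rep-< {a} a∈ a≢r a≡r =
        subst (_< q) (sym (liftParent-col-rep a∈ a≢r a≡r))
          (col-< c₁ (φ a) (parent T₁ (φ a)) (parent-adj T₁ (φ a) a∈ (φ-rep-non-root a≡r a≢r)))

      liftTree-rainbow : Rainbow c₁ T₁ → Rainbow (extendColoring c₁) liftTree
      liftTree-rainbow rainbow a b a∈ a≢r b∈ b≢r a≢b = by-cases (a ≟ rep (φ a)) (b ≟ rep (φ b))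
        where
        by-cases : Dec (a ≡ rep (φ a)) → Dec (b ≡ rep (φ b)) →
                   extendCol c₁ a (liftParent a) ≢ extendCol c₁ b (liftParent b)
        by-cases (yes a≡r) (yes b≡r) e =
          rainbow (φ a) (φ b) a∈ (φ-rep-non-root a≡r a≢r) b∈ (φ-rep-non-root b≡r b≢r)
            (λ φa≡φb → a≢b (trans a≡r (trans (cong rep φa≡φb) (sym b≡r))))
            (trans (sym (liftParent-col-rep a∈ a≢r a≡r)) (trans e (liftParent-col-rep b∈ b≢r b≡r)))
        by-cases (yes a≡r) (no b≢rep) e =
          <-irrefl (trans e (liftParent-col-other b≢rep)) (liftParent-col-rep-< a∈ a≢r a≡r)
        by-cases (no a≢rep) (yes b≡r) e =
          <-irrefl (trans (sym e) (liftParent-col-other a≢rep)) (liftParent-col-rep-< b∈ b≢r b≡r)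
        by-cases (no a≢rep) (no b≢rep) _ = a≢b (non-rep-unique a≢rep b≢rep)

uncontract-4rainbow : ∀ {n q} {G : Graph (suc n)} {G₁ : Graph n} {u v} →
                      ContractEdge G u v G₁ → 4 ≤ n → Rainbow4Coloring G₁ q → Rainbow4Coloring G (suc q)
uncontract-4rainbow CE 4≤n (c₁ , rainbow) = extendColoring c₁ , λ S _ →
  -- φ ∘ S is not injective when S contains both ends of the contracted edge.
  let S₁ , S₁-injective , S₁-covers = injective-cover 4≤n (φ ∘ S)
      T₁ , T₁-rainbow , S₁∈T₁       = rainbow S₁ S₁-injective
  in LiftTree.liftTree T₁ , LiftTree.liftTree-rainbow T₁ c₁ T₁-rainbow , λ i →
       let j , S₁j≡φSi = S₁-covers i in subst (λ x → inT T₁ x ≡ true) S₁j≡φSi (S₁∈T₁ j)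
  where
  open ContractEdge CE
  open Uncontraction CE

contraction-≤ : ∀ {n m} {G : Graph n} {H : Graph m} → Contraction G H → m ≤ n
contraction-≤ (done I)    = injective⇒≤ g-injective
  where
  open Iso I
  g-injective : Injective _≡_ _≡_ g
  g-injective {x} {y} e = trans (sym (fg x)) (trans (cong f e) (fg y))
contraction-≤ (step _ C) = m≤n⇒m≤1+n (contraction-≤ C)

contraction-4rainbow : ∀ {n m q} {G : Graph n} {H : Graph m} → Contraction G H → 4 ≤ m →
                       Rainbow4Coloring H q → Rainbow4Coloring G (q + (n ∸ m))
contraction-4rainbow {q = q} (done I) _ c = weaken-colors (m≤m+n q _) (Pullback.pullback-4rainbow I c)
contraction-4rainbow {suc n} {m} {q} {G} (step CE C) 4≤m c =
  subst (Rainbow4Coloring G) (sym colors-eq)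
    (uncontract-4rainbow CE (≤-trans 4≤m m≤n) (contraction-4rainbow C 4≤m c))
  where
  m≤n : m ≤ n
  m≤n = contraction-≤ C
  colors-eq : q + (suc n ∸ m) ≡ suc (q + (n ∸ m))
  colors-eq = trans (cong (q +_) (+-∸-assoc 1 m≤n)) (+-suc q (n ∸ m))

lemma3p3 : ∀ {n n'} (G : Graph n) (G' : Graph n') → Connected G → Connected G' →
    Contraction G G' → 4 ≤ n' → ∀ k k' → rx4 G k → rx4 G' k' → k ≤ k' + (n ∸ n')
lemma3p3 {n} {n'} G G' _ _ C 4≤n' k k' (_ , k-least) (rainbow' , _) =
  k-least (k' + (n ∸ n')) (contraction-4rainbow C 4≤n' rainbow')
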